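{- Let $\overline{M}$ and $\overline{N}=\mathrm{Hom}(\overline{M},\mathbb{Z})$ be dual lattices of rank $\overline{d}$, and let $\sigma\subseteq \overline{M}_{\mathbb R}$ be a reflexive Gorenstein cone of index $r$, with distinguished lattice points $n_\sigma\in\overline{N}$ and $m_{\sigma^\vee}\in\overline{M}$. Put $\overline{N}^{(r)}:=\overline{N}+\frac1r\mathbb{Z}\,n_\sigma\subseteq \overline{N}_{\mathbb R}$. Then for every facet $\rho$ of the dual cone $\sigma^\vee$, denoting by $\mathrm{lin}(\rho)$ the linear span of $\rho$, one has \[\mathrm{lin}(\rho)\cap\overline{N}=\mathrm{lin}(\rho)\cap\overline{N}^{(r)}.\] In particular $\partial\sigma^\vee\cap\overline{N}=\partial\sigma^\vee\cap\overline{N}^{(r)}$, and for the polytope $\nabla:=\sigma^\vee\cap\{y:\langle m_{\sigma^\vee},y\rangle=1\}$ (the support of $\sigma^\vee$, i.e. the dual Gorenstein polytope $\tilde\Delta^*$ of the support $\tilde\Delta$ of $\sigma$) the set of points of $\overline{N}$ on the relative boundary of $\nabla$ coincides with the set of points of $\overline{N}^{(r)}$ on the relative boundary of $\nabla$ (the latter being the boundary lattice points of the reflexive polytope $(r\tilde\Delta)^*$, which is $\nabla$ regarded with respect to the refined lattice $\overline{N}^{(r)}$).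
   Context: A $\overline{d}$-dimensional rational polyhedral cone $\sigma\subseteq\overline{M}_{\mathbb R}$ with apex $0$ is a Gorenstein cone if it is generated by finitely many lattice points all lying in an affine hyperplane $\{x:\langle x,n\rangle=1\}$ for some $n\in\overline{N}$; this $n=n_\sigma$ is unique and lies in the interior of the dual cone $\sigma^\vee=\{y\in\overline{N}_{\mathbb R}:\langle x,y\rangle\ge 0\ \forall x\in\sigma\}$. The support of $\sigma$ is $\tilde\Delta:=\sigma\cap\{x:\langle x,n_\sigma\rangle=1\}$. The cone $\sigma$ is reflexive if $\sigma^\vee$ is also a Gorenstein cone; then $m_{\sigma^\vee}\in\overline{M}$ denotes the unique lattice point such that the lattice generators of $\sigma^\vee$ lie in $\{y:\langle m_{\sigma^\vee},y\rangle=1\}$, and the index of $\sigma$ is $r=\langle m_{\sigma^\vee},n_\sigma\rangle$. -}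

module Defs where

open import Data.Nat using (ℕ)
open import Data.Fin using (Fin)
open import Data.Integer using (ℤ; +_)
import Data.Integer
open import Data.Rational using (ℚ; _/_; _+_; _*_; _≤_; 0ℚ)
open import Data.Vec.Functional using (foldr)
open import Data.Product using (Σ; _×_; ∃)
open import Relation.Binary.PropositionalEquality using (_≡_)
open import Relation.Nullary using (¬_)

-- Rational vector space ℚ^d (rational points of M_ℝ or N_ℝ), vectors as functions.
Vecℚ : ℕ → Set
Vecℚ d = Fin d → ℚ

-- Lattice ℤ^d (the lattices M̄ and N̄ = Hom(M̄,ℤ), with the standard pairing).
Vecℤ : ℕ → Set
Vecℤ d = Fin d → ℤ

ℤ→ℚ : ℤ → ℚ
ℤ→ℚ z = z / 1

embed : ∀ {d} → Vecℤ d → Vecℚ d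
embed v i = ℤ→ℚ (v i)

Σℚ : ∀ {k} → (Fin k → ℚ) → ℚ
Σℚ f = foldr _+_ 0ℚ f

⟪_,_⟫ : ∀ {d} → Vecℚ d → Vecℚ d → ℚ
⟪ x , y ⟫ = Σℚ (λ i → x i * y i)

lincomb : ∀ {d k} → (Fin k → ℚ) → (Fin k → Vecℚ d) → Vecℚ d
lincomb c p i = Σℚ (λ j → c j * p j i)

Subset : ℕ → Set₁
Subset d = Vecℚ d → Set

IsLattice : ∀ {d} → Vecℚ d → Set
IsLattice {d} x = Σ (Vecℤ d) λ z → ∀ i → x i ≡ ℤ→ℚ (z i)

Cone : ∀ {d k} → (Fin k → Vecℤ d) → Subset d
Cone {d} {k} v x = Σ (Fin k → ℚ) λ c → (∀ j → 0ℚ ≤ c j) × (∀ i → x i ≡ lincomb c (λ j → embed (v j)) i)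

Dual : ∀ {d} → Subset d → Subset d
Dual C y = ∀ x → C x → 0ℚ ≤ ⟪ x , y ⟫

Lin : ∀ {d} → Subset d → Subset d
Lin {d} P x = Σ ℕ λ k → Σ (Fin k → Vecℚ d) λ p → (∀ j → P (p j)) ×
  Σ (Fin k → ℚ) λ c → ∀ i → x i ≡ lincomb c p i

Supports : ∀ {d} → Subset d → Vecℚ d → Set
Supports C u = ∀ y → C y → 0ℚ ≤ ⟪ u , y ⟫

Face : ∀ {d} → Subset d → Vecℚ d → Subset d
Face C u y = C y × ⟪ u , y ⟫ ≡ 0ℚ

ProperFace : ∀ {d} → Subset d → Vecℚ d → Set
ProperFace C u = Supports C u × Σ _ λ y → C y × ¬ (⟪ u , y ⟫ ≡ 0ℚ)

IsFacet : ∀ {d} → Subset d → Vecℚ d → Set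
IsFacet C u = ProperFace C u ×
  (∀ u′ → ProperFace C u′ → (∀ y → Face C u y → Face C u′ y) → ∀ y → Face C u′ y → Face C u y)

-- refined lattice N^(r) = N + (1/r) ℤ n : x = z + (k/r) n, written as r·x = r·z + k·n
InRefined : ∀ {d} → ℤ → Vecℤ d → Vecℚ d → Set
InRefined {d} r n x = Σ (Vecℤ d) λ z → Σ ℤ λ k →
  ∀ i → ℤ→ℚ r * x i ≡ ℤ→ℚ r * ℤ→ℚ (z i) + ℤ→ℚ k * ℤ→ℚ (n i)

-- integer pairing ⟨m , n⟩ of lattice vectors (used for the index r = ⟨m_σ∨ , n_σ⟩)
⟪_,_⟫ℤ : ∀ {d} → Vecℤ d → Vecℤ d → ℤ
⟪ m , n ⟫ℤ = foldr Data.Integer._+_ (+ 0) (λ i → Data.Integer._*_ (m i) (n i))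

-- A proper face ρ = σ^∨ ∩ u^⊥ of σ^∨ is orthogonal to some generator v of σ: otherwise the sum
-- y* of the generators of σ^∨ lying on ρ pairs positively with every generator of σ, so
-- t·y* − y ∈ σ^∨ for every y ∈ σ^∨ and large t, and then u vanishes on all of σ^∨.
-- A point x = z + (k/r)·n_σ of N^(r) with z ∈ N in lin(ρ) satisfies 0 = ⟨v , x⟩ = ⟨v , z⟩ + k/r,
-- because ⟨v , n_σ⟩ = 1; hence k/r is an integer and x ∈ N.  The index r is nonzero because
-- n_σ ∈ σ^∨ is a nonzero nonnegative combination of generators of height 1.
module Submission where

open import Defs
open import Data.Nat using (ℕ; zero; suc)
open import Data.Fin using (Fin; zero; suc)
open import Data.Fin.Properties using (any?)
open import Data.Integer using (ℤ; +_)
import Data.Integer as ℤ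
import Data.Integer.Properties as ℤ
open import Data.Rational using (ℚ; _+_; _*_; -_; _-_; _≤_; 0ℚ; 1ℚ; 1/_; toℚᵘ; ≢-nonZero; nonNegative)
open import Data.Rational.Properties
import Data.Rational.Unnormalised as ℚᵘ
import Data.Rational.Unnormalised.Properties as ℚᵘ
open import Algebra.Properties.Group +-0-group using (inverseʳ-unique)
open import Algebra.Bundles using (Ring)
open import Algebra.Properties.Semiring.Sum (Ring.semiring +-*-ring)
  using (sum-cong-≗; sum-replicate-zero; ∑-comm; ∑-distrib-+; *-distribˡ-sum)
open import Data.Product using (Σ; _×_; _,_; proj₁; proj₂)
open import Data.Empty using (⊥-elim)
open import Data.Maybe using (nothing)
open import Relation.Nullary using (¬_; Dec; yes; no)
open import Relation.Binary.PropositionalEquality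
open import Tactic.RingSolver using (solve-∀)
open import Tactic.RingSolver.Core.AlmostCommutativeRing using (AlmostCommutativeRing; fromCommutativeRing)

ℚ-ring : AlmostCommutativeRing _ _
ℚ-ring = fromCommutativeRing +-*-commutativeRing (λ _ → nothing)

ℤ→ℚ-toℚᵘ : ∀ a → toℚᵘ (ℤ→ℚ a) ℚᵘ.≃ ℚᵘ.mkℚᵘ a 0
ℤ→ℚ-toℚᵘ a = toℚᵘ-fromℚᵘ (ℚᵘ.mkℚᵘ a 0)

ℤ→ℚ-homo-+ : ∀ a b → ℤ→ℚ (a ℤ.+ b) ≡ ℤ→ℚ a + ℤ→ℚ b
ℤ→ℚ-homo-+ a b = toℚᵘ-injective (ℚᵘ.≃-trans (ℤ→ℚ-toℚᵘ (a ℤ.+ b)) (ℚᵘ.≃-trans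
  (ℚᵘ.*≡* (cong₂ ℤ._*_ (cong₂ ℤ._+_ (sym (ℤ.*-identityʳ a)) (sym (ℤ.*-identityʳ b))) refl))
  (ℚᵘ.≃-sym (ℚᵘ.≃-trans (toℚᵘ-homo-+ (ℤ→ℚ a) (ℤ→ℚ b))
    (ℚᵘ.+-cong (ℤ→ℚ-toℚᵘ a) (ℤ→ℚ-toℚᵘ b))))))

ℤ→ℚ-homo-* : ∀ a b → ℤ→ℚ (a ℤ.* b) ≡ ℤ→ℚ a * ℤ→ℚ b
ℤ→ℚ-homo-* a b = toℚᵘ-injective (ℚᵘ.≃-trans (ℤ→ℚ-toℚᵘ (a ℤ.* b))
  (ℚᵘ.≃-sym (ℚᵘ.≃-trans (toℚᵘ-homo-* (ℤ→ℚ a) (ℤ→ℚ b))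
    (ℚᵘ.*-cong (ℤ→ℚ-toℚᵘ a) (ℤ→ℚ-toℚᵘ b)))))

ℤ→ℚ-homo‿- : ∀ a → ℤ→ℚ (ℤ.- a) ≡ - ℤ→ℚ a
ℤ→ℚ-homo‿- a = toℚᵘ-injective (ℚᵘ.≃-trans (ℤ→ℚ-toℚᵘ (ℤ.- a))
  (ℚᵘ.≃-sym (ℚᵘ.≃-trans (toℚᵘ-homo‿- (ℤ→ℚ a)) (ℚᵘ.-‿cong (ℤ→ℚ-toℚᵘ a)))))

⟪embed⟫≡⟪⟫ℤ : ∀ {d} (a b : Vecℤ d) → ⟪ embed a , embed b ⟫ ≡ ℤ→ℚ ⟪ a , b ⟫ℤ
⟪embed⟫≡⟪⟫ℤ {zero} a b = refl
⟪embed⟫≡⟪⟫ℤ {suc d} a b = trans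
  (cong₂ _+_ (sym (ℤ→ℚ-homo-* (a zero) (b zero))) (⟪embed⟫≡⟪⟫ℤ (λ i → a (suc i)) (λ i → b (suc i))))
  (sym (ℤ→ℚ-homo-+ (a zero ℤ.* b zero) ⟪ (λ i → a (suc i)) , (λ i → b (suc i)) ⟫ℤ))

*-cancelˡ-≡ : ∀ {r p q : ℚ} → ¬ r ≡ 0ℚ → r * p ≡ r * q → p ≡ q
*-cancelˡ-≡ {r} {p} {q} r≢0 rp≡rq = begin
    p                 ≡⟨ sym (*-identityˡ p) ⟩
    1ℚ * p            ≡⟨ cong (_* p) (sym (*-inverseˡ r)) ⟩
    ((1/ r) * r) * p  ≡⟨ *-assoc (1/ r) r p ⟩
    (1/ r) * (r * p)  ≡⟨ cong ((1/ r) *_) rp≡rq ⟩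
    (1/ r) * (r * q)  ≡⟨ sym (*-assoc (1/ r) r q) ⟩
    ((1/ r) * r) * q  ≡⟨ cong (_* q) (*-inverseˡ r) ⟩
    1ℚ * q            ≡⟨ *-identityˡ q ⟩
    q                 ∎
  where
  open ≡-Reasoning
  instance _ = ≢-nonZero r≢0

p*q≡0∧q≢0⇒p≡0 : ∀ {p q : ℚ} → ¬ q ≡ 0ℚ → p * q ≡ 0ℚ → p ≡ 0ℚ
p*q≡0∧q≢0⇒p≡0 {p} {q} q≢0 pq≡0 =
  *-cancelˡ-≡ {q} {p} {0ℚ} q≢0 (trans (*-comm q p) (trans pq≡0 (sym (*-zeroʳ q))))

0≤1 : 0ℚ ≤ 1ℚ
0≤1 = ≤ᵇ⇒≤ _

*-nonNeg : ∀ {p q : ℚ} → 0ℚ ≤ p → 0ℚ ≤ q → 0ℚ ≤ p * q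
*-nonNeg {p} {q} 0≤p 0≤q =
  nonNegative⁻¹ _ {{nonNeg*nonNeg⇒nonNeg p {{nonNegative 0≤p}} q {{nonNegative 0≤q}}}}

p≤q⇒0≤q-p : ∀ {p q : ℚ} → p ≤ q → 0ℚ ≤ q - p
p≤q⇒0≤q-p {p} {q} p≤q = subst (_≤ q - p) (+-inverseʳ p) (+-monoˡ-≤ (- p) p≤q)

0≤-p⇒p≤0 : ∀ {p : ℚ} → 0ℚ ≤ - p → p ≤ 0ℚ
0≤-p⇒p≤0 {p} 0≤-p = subst₂ _≤_ (+-identityʳ p) (+-inverseʳ p) (+-monoʳ-≤ p 0≤-p)

∑-neg : ∀ {k} (f : Fin k → ℚ) → Σℚ (λ i → - f i) ≡ - Σℚ f
∑-neg {zero} f = refl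
∑-neg {suc k} f = trans (cong (_+_ (- f zero)) (∑-neg (λ i → f (suc i)))) (sym (neg-distrib-+ (f zero) _))

∑-nonNeg : ∀ {k} {f : Fin k → ℚ} → (∀ i → 0ℚ ≤ f i) → 0ℚ ≤ Σℚ f
∑-nonNeg {zero} _ = ≤-refl
∑-nonNeg {suc k} 0≤f = +-mono-≤ (0≤f zero) (∑-nonNeg (λ i → 0≤f (suc i)))

∑-nonNeg-term≤ : ∀ {k} {f : Fin k → ℚ} → (∀ i → 0ℚ ≤ f i) → ∀ i → f i ≤ Σℚ f
∑-nonNeg-term≤ {suc k} {f} 0≤f zero =
  subst (_≤ Σℚ f) (+-identityʳ (f zero)) (+-monoʳ-≤ (f zero) (∑-nonNeg (λ i → 0≤f (suc i))))
∑-nonNeg-term≤ {suc k} {f} 0≤f (suc i) =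
  subst (_≤ Σℚ f) (+-identityˡ (f (suc i)))
    (+-mono-≤ (0≤f zero) (∑-nonNeg-term≤ (λ i → 0≤f (suc i)) i))

∑-nonNeg-≡0 : ∀ {k} {f : Fin k → ℚ} → (∀ i → 0ℚ ≤ f i) → Σℚ f ≡ 0ℚ → ∀ i → f i ≡ 0ℚ
∑-nonNeg-≡0 0≤f ∑f≡0 i = ≤-antisym (subst (_ ≤_) ∑f≡0 (∑-nonNeg-term≤ 0≤f i)) (0≤f i)

δ : ∀ {k} → Fin k → Fin k → ℚ
δ zero    zero    = 1ℚ
δ zero    (suc _) = 0ℚ
δ (suc _) zero    = 0ℚ
δ (suc j) (suc i) = δ j i

δ-nonNeg : ∀ {k} (j i : Fin k) → 0ℚ ≤ δ j i
δ-nonNeg zero    zero    = 0≤1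
δ-nonNeg zero    (suc _) = ≤-refl
δ-nonNeg (suc _) zero    = ≤-refl
δ-nonNeg (suc j) (suc i) = δ-nonNeg j i

∑-δ : ∀ {k} (j : Fin k) (f : Fin k → ℚ) → Σℚ (λ i → δ j i * f i) ≡ f j
∑-δ {suc k} zero f = trans
  (cong₂ _+_ (*-identityˡ (f zero)) (trans (sum-cong-≗ (λ i → *-zeroˡ (f (suc i)))) (sum-replicate-zero k)))
  (+-identityʳ (f zero))
∑-δ (suc j) f = trans (cong₂ _+_ (*-zeroˡ (f zero)) (∑-δ j (λ i → f (suc i)))) (+-identityˡ _)

𝟙 : ∀ {P : Set} → Dec P → ℚ
𝟙 (yes _) = 1ℚ
𝟙 (no _)  = 0ℚ

𝟙-nonNeg : ∀ {P : Set} (p? : Dec P) → 0ℚ ≤ 𝟙 p?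
𝟙-nonNeg (yes _) = 0≤1
𝟙-nonNeg (no _)  = ≤-refl

𝟙[≡0]-annihilates : ∀ {q : ℚ} (q≟0 : Dec (q ≡ 0ℚ)) → 𝟙 q≟0 * q ≡ 0ℚ
𝟙[≡0]-annihilates {q} (yes q≡0) = trans (cong (1ℚ *_) q≡0) (*-zeroʳ 1ℚ)
𝟙[≡0]-annihilates {q} (no _)    = *-zeroˡ q

𝟙-cancel : ∀ {c q a : ℚ} (q≟0 : Dec (q ≡ 0ℚ)) → c * q ≡ 0ℚ → 𝟙 q≟0 * a ≡ 0ℚ → c * a ≡ 0ℚ
𝟙-cancel {c} {q} {a} (yes _) _ 1a≡0 = trans (cong (c *_) (trans (sym (*-identityˡ a)) 1a≡0)) (*-zeroʳ c)
𝟙-cancel {c} {q} {a} (no q≢0) cq≡0 _ =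
  trans (cong (_* a) (p*q≡0∧q≢0⇒p≡0 {c} {q} q≢0 cq≡0)) (*-zeroˡ a)

⟪⟫-comm : ∀ {d} (x y : Vecℚ d) → ⟪ x , y ⟫ ≡ ⟪ y , x ⟫
⟪⟫-comm x y = sum-cong-≗ (λ i → *-comm (x i) (y i))

⟪⟫-lincombʳ : ∀ {d k} (a y : Vecℚ d) (c : Fin k → ℚ) (p : Fin k → Vecℚ d) →
  (∀ i → y i ≡ lincomb c p i) → ⟪ a , y ⟫ ≡ Σℚ (λ j → c j * ⟪ a , p j ⟫)
⟪⟫-lincombʳ a y c p y≡∑cp = begin
  Σℚ (λ i → a i * y i)
    ≡⟨ sum-cong-≗ (λ i → cong (a i *_) (y≡∑cp i)) ⟩
  Σℚ (λ i → a i * lincomb c p i)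
    ≡⟨ sum-cong-≗ (λ i → *-distribˡ-sum (a i) (λ j → c j * p j i)) ⟩
  Σℚ (λ i → Σℚ (λ j → a i * (c j * p j i)))
    ≡⟨ sum-cong-≗ (λ i → sum-cong-≗ (λ j → swap-factors (a i) (c j) (p j i))) ⟩
  Σℚ (λ i → Σℚ (λ j → c j * (a i * p j i)))
    ≡⟨ ∑-comm (λ i j → c j * (a i * p j i)) ⟩
  Σℚ (λ j → Σℚ (λ i → c j * (a i * p j i)))
    ≡⟨ sum-cong-≗ (λ j → sym (*-distribˡ-sum (c j) (λ i → a i * p j i))) ⟩
  Σℚ (λ j → c j * ⟪ a , p j ⟫)
    ∎
  where
  open ≡-Reasoning
  swap-factors : ∀ (x y z : ℚ) → x * (y * z) ≡ y * (x * z)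
  swap-factors = solve-∀ ℚ-ring

⟪⟫-lincombˡ : ∀ {d k} (x b : Vecℚ d) (c : Fin k → ℚ) (p : Fin k → Vecℚ d) →
  (∀ i → x i ≡ lincomb c p i) → ⟪ x , b ⟫ ≡ Σℚ (λ j → c j * ⟪ p j , b ⟫)
⟪⟫-lincombˡ x b c p x≡∑cp = trans (⟪⟫-comm x b) (trans (⟪⟫-lincombʳ b x c p x≡∑cp)
  (sum-cong-≗ (λ j → cong (c j *_) (⟪⟫-comm b (p j)))))

⟪⟫-+ʳ : ∀ {d} (a b c : Vecℚ d) → ⟪ a , (λ i → b i + c i) ⟫ ≡ ⟪ a , b ⟫ + ⟪ a , c ⟫
⟪⟫-+ʳ a b c = trans (sum-cong-≗ (λ i → *-distribˡ-+ (a i) (b i) (c i)))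
  (∑-distrib-+ (λ i → a i * b i) (λ i → a i * c i))

⟪⟫-*ʳ : ∀ {d} (a b : Vecℚ d) (α : ℚ) → ⟪ a , (λ i → α * b i) ⟫ ≡ α * ⟪ a , b ⟫
⟪⟫-*ʳ a b α = trans
  (sum-cong-≗ (λ i → trans (sym (*-assoc (a i) α (b i)))
    (trans (cong (_* b i) (*-comm (a i) α)) (*-assoc α (a i) (b i)))))
  (sym (*-distribˡ-sum α (λ i → a i * b i)))

⟪⟫-negʳ : ∀ {d} (a b : Vecℚ d) → ⟪ a , (λ i → - b i) ⟫ ≡ - ⟪ a , b ⟫
⟪⟫-negʳ a b = trans (sum-cong-≗ (λ i → sym (neg-distribʳ-* (a i) (b i)))) (∑-neg (λ i → a i * b i))

⟪⟫-zeroʳ : ∀ {d} (a y : Vecℚ d) → (∀ i → y i ≡ 0ℚ) → ⟪ a , y ⟫ ≡ 0ℚ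
⟪⟫-zeroʳ {d} a y y≡0 =
  trans (sum-cong-≗ (λ i → trans (cong (a i *_) (y≡0 i)) (*-zeroʳ (a i)))) (sum-replicate-zero d)

Lin-orthogonal : ∀ {d} {P : Subset d} (a : Vecℚ d) →
  (∀ y → P y → ⟪ a , y ⟫ ≡ 0ℚ) → ∀ x → Lin P x → ⟪ a , x ⟫ ≡ 0ℚ
Lin-orthogonal a a⊥P x (k , p , p∈P , c , x≡∑cp) = trans (⟪⟫-lincombʳ a x c p x≡∑cp)
  (trans (sum-cong-≗ (λ j → trans (cong (c j *_) (a⊥P (p j) (p∈P j))) (*-zeroʳ (c j))))
    (sum-replicate-zero k))

IsLattice⇒InRefined : ∀ {d} (r : ℤ) (n : Vecℤ d) {x : Vecℚ d} → IsLattice x → InRefined r n x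
IsLattice⇒InRefined r n (z , x≡z) = z , + 0 , λ i → begin
  ℤ→ℚ r * _                           ≡⟨ cong (ℤ→ℚ r *_) (x≡z i) ⟩
  ℤ→ℚ r * ℤ→ℚ (z i)                   ≡⟨ sym (+-identityʳ _) ⟩
  ℤ→ℚ r * ℤ→ℚ (z i) + 0ℚ              ≡⟨ cong (_+_ (ℤ→ℚ r * ℤ→ℚ (z i))) (sym (*-zeroˡ (ℤ→ℚ (n i)))) ⟩
  ℤ→ℚ r * ℤ→ℚ (z i) + 0ℚ * ℤ→ℚ (n i) ∎
  where open ≡-Reasoning

InRefined⇒IsLattice : ∀ {d} (r : ℤ) (n : Vecℤ d) {x : Vecℚ d} (a : Vecℤ d) →
  ⟪ embed a , embed n ⟫ ≡ 1ℚ → ⟪ embed a , x ⟫ ≡ 0ℚ → ¬ ℤ→ℚ r ≡ 0ℚ →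
  InRefined r n x → IsLattice x
InRefined⇒IsLattice {d} r n {x} a ⟪a,n⟫≡1 ⟪a,x⟫≡0 r≢0 (z , k , rx≡rz+kn) =
  (λ i → z i ℤ.- b ℤ.* n i) , λ i → *-cancelˡ-≡ r≢0 (begin
    R * x i                         ≡⟨ rx≡rz+kn i ⟩
    R * Z i + K * N i               ≡⟨ cong (λ t → R * Z i + t * N i) K≡-Rb ⟩
    R * Z i + - (R * B) * N i       ≡⟨ factor-R R (Z i) B (N i) ⟩
    R * (Z i - B * N i)             ≡⟨ cong (R *_) (sym (lattice-coordinate i)) ⟩
    R * ℤ→ℚ (z i ℤ.- b ℤ.* n i)     ∎)
  where
  open ≡-Reasoning
  b : ℤ
  b = ⟪ a , z ⟫ℤ
  R K B : ℚ
  R = ℤ→ℚ r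
  K = ℤ→ℚ k
  B = ℤ→ℚ b
  Z N A : Vecℚ d
  Z = embed z
  N = embed n
  A = embed a
  factor-R : ∀ (R Z B N : ℚ) → R * Z + - (R * B) * N ≡ R * (Z - B * N)
  factor-R = solve-∀ ℚ-ring
  lattice-coordinate : ∀ i → ℤ→ℚ (z i ℤ.- b ℤ.* n i) ≡ Z i - B * N i
  lattice-coordinate i = trans (ℤ→ℚ-homo-+ (z i) (ℤ.- (b ℤ.* n i)))
    (cong (_+_ (Z i)) (trans (ℤ→ℚ-homo‿- (b ℤ.* n i)) (cong -_ (ℤ→ℚ-homo-* b (n i)))))
  Rb+K≡0 : R * B + K ≡ 0ℚ
  Rb+K≡0 = begin
    R * B + K                         ≡⟨ cong (_+_ (R * B)) (*-identityʳ K) ⟨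
    R * B + K * 1ℚ                    ≡⟨ cong₂ (λ s t → R * s + K * t) (⟪embed⟫≡⟪⟫ℤ a z) ⟪a,n⟫≡1 ⟨
    R * ⟪ A , Z ⟫ + K * ⟪ A , N ⟫      ≡⟨ cong₂ _+_ (⟪⟫-*ʳ A Z R) (⟪⟫-*ʳ A N K) ⟨
    ⟪ A , (λ i → R * Z i) ⟫ + ⟪ A , (λ i → K * N i) ⟫ ≡⟨ ⟪⟫-+ʳ A _ _ ⟨
    ⟪ A , (λ i → R * Z i + K * N i) ⟫  ≡⟨ sum-cong-≗ (λ i → cong (A i *_) (rx≡rz+kn i)) ⟨
    ⟪ A , (λ i → R * x i) ⟫            ≡⟨ ⟪⟫-*ʳ A x R ⟩
    R * ⟪ A , x ⟫                      ≡⟨ cong (R *_) ⟪a,x⟫≡0 ⟩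
    R * 0ℚ                             ≡⟨ *-zeroʳ R ⟩
    0ℚ                                 ∎
  K≡-Rb : K ≡ - (R * B)
  K≡-Rb = inverseʳ-unique (R * B) K Rb+K≡0

module _ {d k : ℕ} (v : Fin k → Vecℤ d) where

  Cone-generator : ∀ j → Cone v (embed (v j))
  Cone-generator j = δ j , δ-nonNeg j , λ i → sym (∑-δ j (λ j′ → embed (v j′) i))

  Dual-Cone-intro : ∀ y → (∀ j → 0ℚ ≤ ⟪ embed (v j) , y ⟫) → Dual (Cone v) y
  Dual-Cone-intro y 0≤⟪v,y⟫ x (c , 0≤c , x≡∑cv) =
    subst (0ℚ ≤_) (sym (⟪⟫-lincombˡ x y c (λ j → embed (v j)) x≡∑cv))
      (∑-nonNeg (λ j → *-nonNeg (0≤c j) (0≤⟪v,y⟫ j)))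

  Dual-absorbs : ∀ {y* y} → Dual (Cone v) y* → (∀ j → ¬ ⟪ embed (v j) , y* ⟫ ≡ 0ℚ) →
    Dual (Cone v) y → Σ ℚ λ t → Dual (Cone v) (λ i → t * y* i - y i)
  Dual-absorbs {y*} {y} y*∈σ∨ q≢0 y∈σ∨ =
    t , Dual-Cone-intro _ (λ j → subst (0ℚ ≤_) (sym (pairing j)) (p≤q⇒0≤q-p (a≤tq j)))
    where
    V : Fin k → Vecℚ d
    V j = embed (v j)
    q a : Fin k → ℚ
    q j = ⟪ V j , y* ⟫
    a j = ⟪ V j , y ⟫
    0≤q : ∀ j → 0ℚ ≤ q j
    0≤q j = y*∈σ∨ (V j) (Cone-generator j)
    0≤1/q : ∀ j → 0ℚ ≤ (1/ q j) {{≢-nonZero (q≢0 j)}}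
    0≤1/q j = <⇒≤ (positive⁻¹ _ {{1/pos⇒pos (q j) {{nonNeg∧nonZero⇒pos (q j)
                {{nonNegative (0≤q j)}} {{≢-nonZero (q≢0 j)}}}}}})
    ratio : Fin k → ℚ
    ratio j = a j * (1/ q j) {{≢-nonZero (q≢0 j)}}
    t : ℚ
    t = Σℚ ratio
    ratio-q : ∀ j → ratio j * q j ≡ a j
    ratio-q j = trans (*-assoc (a j) _ (q j))
      (trans (cong (a j *_) (*-inverseˡ (q j) {{≢-nonZero (q≢0 j)}})) (*-identityʳ (a j)))
    a≤tq : ∀ j → a j ≤ t * q j
    a≤tq j = subst (_≤ t * q j) (ratio-q j) (*-monoʳ-≤-nonNeg (q j) {{nonNegative (0≤q j)}}
      (∑-nonNeg-term≤ (λ j′ → *-nonNeg (y∈σ∨ (V j′) (Cone-generator j′)) (0≤1/q j′)) j))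
    pairing : ∀ j → ⟪ V j , (λ i → t * y* i - y i) ⟫ ≡ t * q j - a j
    pairing j = trans (⟪⟫-+ʳ (V j) (λ i → t * y* i) (λ i → - y i))
      (cong₂ _+_ (⟪⟫-*ʳ (V j) y* t) (⟪⟫-negʳ (V j) y))

  support-through-interior : ∀ {u y*} → Supports (Dual (Cone v)) u → Dual (Cone v) y* →
    (∀ j → ¬ ⟪ embed (v j) , y* ⟫ ≡ 0ℚ) → ⟪ u , y* ⟫ ≡ 0ℚ →
    ∀ y → Dual (Cone v) y → ⟪ u , y ⟫ ≡ 0ℚ
  support-through-interior {u} {y*} u-supports y*∈σ∨ q≢0 ⟪u,y*⟫≡0 y y∈σ∨ =
    ≤-antisym (0≤-p⇒p≤0 (subst (0ℚ ≤_) ⟪u,z⟫≡-⟪u,y⟫ (u-supports _ z∈σ∨))) (u-supports y y∈σ∨)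
    where
    t : ℚ
    t = proj₁ (Dual-absorbs y*∈σ∨ q≢0 y∈σ∨)
    z∈σ∨ : Dual (Cone v) (λ i → t * y* i - y i)
    z∈σ∨ = proj₂ (Dual-absorbs y*∈σ∨ q≢0 y∈σ∨)
    ⟪u,z⟫≡-⟪u,y⟫ : ⟪ u , (λ i → t * y* i - y i) ⟫ ≡ - ⟪ u , y ⟫
    ⟪u,z⟫≡-⟪u,y⟫ = begin
      ⟪ u , (λ i → t * y* i - y i) ⟫  ≡⟨ ⟪⟫-+ʳ u (λ i → t * y* i) (λ i → - y i) ⟩
      _                               ≡⟨ cong₂ _+_ (⟪⟫-*ʳ u y* t) (⟪⟫-negʳ u y) ⟩
      t * ⟪ u , y* ⟫ - ⟪ u , y ⟫       ≡⟨ cong (λ s → t * s - ⟪ u , y ⟫) ⟪u,y*⟫≡0 ⟩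
      t * 0ℚ - ⟪ u , y ⟫               ≡⟨ cong (_- ⟪ u , y ⟫) (*-zeroʳ t) ⟩
      0ℚ - ⟪ u , y ⟫                   ≡⟨ +-identityˡ (- ⟪ u , y ⟫) ⟩
      - ⟪ u , y ⟫                      ∎
      where open ≡-Reasoning

module _ {d k l : ℕ} (v : Fin k → Vecℤ d) (w : Fin l → Vecℤ d)
    (σ∨⊆Cone : ∀ y → Dual (Cone v) y → Cone w y) (Cone⊆σ∨ : ∀ y → Cone w y → Dual (Cone v) y)
    (u : Vecℚ d) (u-supports : Supports (Dual (Cone v)) u) where

  private
    V W : _ → Vecℚ d
    V j = embed (v j)
    W i = embed (w i)
    W∈σ∨ : ∀ i → Dual (Cone v) (W i)
    W∈σ∨ i = Cone⊆σ∨ (W i) (Cone-generator w i)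

  onFace? : ∀ i → Dec (⟪ u , W i ⟫ ≡ 0ℚ)
  onFace? i = ⟪ u , W i ⟫ ≟ 0ℚ

  onFace : Fin l → ℚ
  onFace i = 𝟙 (onFace? i)

  facePoint : Vecℚ d
  facePoint = lincomb onFace W

  facePoint∈σ∨ : Dual (Cone v) facePoint
  facePoint∈σ∨ = Cone⊆σ∨ facePoint (onFace , (λ i → 𝟙-nonNeg (onFace? i)) , λ _ → refl)

  u⊥facePoint : ⟪ u , facePoint ⟫ ≡ 0ℚ
  u⊥facePoint = trans (⟪⟫-lincombʳ u facePoint onFace W (λ _ → refl))
    (trans (sum-cong-≗ (λ i → 𝟙[≡0]-annihilates (onFace? i))) (sum-replicate-zero l))

  facePoint-orthogonal : ∀ j → ⟪ V j , facePoint ⟫ ≡ 0ℚ →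
    ∀ y → Face (Dual (Cone v)) u y → ⟪ V j , y ⟫ ≡ 0ℚ
  facePoint-orthogonal j ⟪v,p⟫≡0 y (y∈σ∨ , ⟪u,y⟫≡0) with σ∨⊆Cone y y∈σ∨
  ... | c , 0≤c , y≡∑cw =
    trans (⟪⟫-lincombʳ (V j) y c W y≡∑cw) (trans (sum-cong-≗ term≡0) (sum-replicate-zero l))
    where
    c⟪u,w⟫≡0 : ∀ i → c i * ⟪ u , W i ⟫ ≡ 0ℚ
    c⟪u,w⟫≡0 = ∑-nonNeg-≡0 (λ i → *-nonNeg (0≤c i) (u-supports (W i) (W∈σ∨ i)))
      (trans (sym (⟪⟫-lincombʳ u y c W y≡∑cw)) ⟪u,y⟫≡0)
    onFace⟪v,w⟫≡0 : ∀ i → onFace i * ⟪ V j , W i ⟫ ≡ 0ℚ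
    onFace⟪v,w⟫≡0 =
      ∑-nonNeg-≡0 (λ i → *-nonNeg (𝟙-nonNeg (onFace? i)) (W∈σ∨ i (V j) (Cone-generator v j)))
      (trans (sym (⟪⟫-lincombʳ (V j) facePoint onFace W (λ _ → refl))) ⟪v,p⟫≡0)
    term≡0 : ∀ i → c i * ⟪ V j , W i ⟫ ≡ 0ℚ
    term≡0 i =
      𝟙-cancel {c i} {⟪ u , W i ⟫} {⟪ V j , W i ⟫} (onFace? i) (c⟪u,w⟫≡0 i) (onFace⟪v,w⟫≡0 i)

  proper⇒orthogonal-generator : Σ (Vecℚ d) (λ y → Dual (Cone v) y × ¬ ⟪ u , y ⟫ ≡ 0ℚ) →
    Σ (Fin k) λ j → ∀ y → Face (Dual (Cone v)) u y → ⟪ V j , y ⟫ ≡ 0ℚ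
  proper⇒orthogonal-generator (y , y∈σ∨ , ⟪u,y⟫≢0) with any? (λ j → ⟪ V j , facePoint ⟫ ≟ 0ℚ)
  ... | yes (j , ⟪v,p⟫≡0) = j , facePoint-orthogonal j ⟪v,p⟫≡0
  ... | no none = ⊥-elim (⟪u,y⟫≢0 (support-through-interior v {u} u-supports facePoint∈σ∨
        (λ j ⟪v,p⟫≡0 → none (j , ⟪v,p⟫≡0)) u⊥facePoint y y∈σ∨))

Cone-height-zero⇒zero : ∀ {d l} (w : Fin l → Vecℤ d) (m : Vecℤ d) {y : Vecℚ d} →
  (∀ i → ⟪ embed m , embed (w i) ⟫ ≡ 1ℚ) → Cone w y → ⟪ embed m , y ⟫ ≡ 0ℚ → ∀ i → y i ≡ 0ℚ
Cone-height-zero⇒zero {l = l} w m {y} ⟪m,w⟫≡1 (c , 0≤c , y≡∑cw) ⟪m,y⟫≡0 i =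
  trans (y≡∑cw i) (trans
    (sum-cong-≗ (λ j → trans (cong (_* embed (w j) i) (c≡0 j)) (*-zeroˡ (embed (w j) i))))
    (sum-replicate-zero l))
  where
  c≡0 : ∀ j → c j ≡ 0ℚ
  c≡0 j = trans (sym (*-identityʳ (c j))) (∑-nonNeg-≡0 (λ j → *-nonNeg (0≤c j) 0≤1)
    (trans (sum-cong-≗ (λ j → cong (c j *_) (sym (⟪m,w⟫≡1 j))))
      (trans (sym (⟪⟫-lincombʳ (embed m) y c (λ j → embed (w j)) y≡∑cw)) ⟪m,y⟫≡0)) j)

index≢0 : ∀ {d k l} (v : Fin k → Vecℤ d) (n : Vecℤ d) (w : Fin l → Vecℤ d) (m : Vecℤ d) →
  Fin k → (∀ j → ⟪ embed (v j) , embed n ⟫ ≡ 1ℚ) → (∀ i → ⟪ embed m , embed (w i) ⟫ ≡ 1ℚ) →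
  (∀ y → Dual (Cone v) y → Cone w y) → ¬ ℤ→ℚ ⟪ m , n ⟫ℤ ≡ 0ℚ
index≢0 v n w m j ⟪v,n⟫≡1 ⟪m,w⟫≡1 σ∨⊆Cone r≡0 =
  1≢0 (trans (sym (⟪v,n⟫≡1 j)) (⟪⟫-zeroʳ (embed (v j)) (embed n) n≡0))
  where
  n∈σ∨ : Dual (Cone v) (embed n)
  n∈σ∨ = Dual-Cone-intro v (embed n) (λ j → subst (0ℚ ≤_) (sym (⟪v,n⟫≡1 j)) 0≤1)
  n≡0 : ∀ i → embed n i ≡ 0ℚ
  n≡0 = Cone-height-zero⇒zero w m ⟪m,w⟫≡1 (σ∨⊆Cone (embed n) n∈σ∨) (trans (⟪embed⟫≡⟪⟫ℤ m n) r≡0)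

proposition1p16 :
    (d k l : ℕ)
    -- σ = cone generated by lattice points v_j with ⟨v_j , n_σ⟩ = 1 (Gorenstein)
    (v : Fin k → Vecℤ d) (nσ : Vecℤ d) →
    (∀ j → ⟪ embed (v j) , embed nσ ⟫ ≡ ℤ→ℚ (+ 1)) →
    -- σ is d-dimensional: the generators span ℚ^d
    (∀ x → Lin (Cone v) x) →
    -- σ^∨ is Gorenstein: generated by lattice points w_j with ⟨m_σ∨ , w_j⟩ = 1
    (w : Fin l → Vecℤ d) (mσ∨ : Vecℤ d) →
    (∀ j → ⟪ embed mσ∨ , embed (w j) ⟫ ≡ ℤ→ℚ (+ 1)) →
    (∀ y → (Dual (Cone v) y → Cone w y) × (Cone w y → Dual (Cone v) y)) →
    -- for every facet ρ = σ^∨ ∩ u^⊥ of σ^∨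
    (u : Vecℚ d) → IsFacet (Dual (Cone v)) u →
    -- lin(ρ) ∩ N = lin(ρ) ∩ N^(r),  r = ⟨m_σ∨ , n_σ⟩
    ∀ x →
      ((Lin (Face (Dual (Cone v)) u) x × IsLattice x) →
        (Lin (Face (Dual (Cone v)) u) x × InRefined ⟪ mσ∨ , nσ ⟫ℤ nσ x))
      × ((Lin (Face (Dual (Cone v)) u) x × InRefined ⟪ mσ∨ , nσ ⟫ℤ nσ x) →
        (Lin (Face (Dual (Cone v)) u) x × IsLattice x))
proposition1p16 d k l v nσ ⟪v,n⟫≡1 _ w mσ∨ ⟪m,w⟫≡1 dual u ((u-supports , proper) , _) x =
    (λ (x∈linρ , x∈N) → x∈linρ , IsLattice⇒InRefined ⟪ mσ∨ , nσ ⟫ℤ nσ x∈N)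
  , (λ (x∈linρ , x∈N⁽ʳ⁾) → x∈linρ , InRefined⇒IsLattice ⟪ mσ∨ , nσ ⟫ℤ nσ (v j) (⟪v,n⟫≡1 j)
       (Lin-orthogonal {P = Face (Dual (Cone v)) u} (embed (v j)) v⊥ρ x x∈linρ)
       (index≢0 v nσ w mσ∨ j ⟪v,n⟫≡1 ⟪m,w⟫≡1 σ∨⊆Cone) x∈N⁽ʳ⁾)
  where
  σ∨⊆Cone : ∀ y → Dual (Cone v) y → Cone w y
  σ∨⊆Cone y = proj₁ (dual y)
  orthogonal : Σ (Fin k) λ j → ∀ y → Face (Dual (Cone v)) u y → ⟪ embed (v j) , y ⟫ ≡ 0ℚ
  orthogonal = proper⇒orthogonal-generator v w σ∨⊆Cone (λ y → proj₂ (dual y)) u u-supports proper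
  j : Fin k
  j = proj₁ orthogonal
  v⊥ρ : ∀ y → Face (Dual (Cone v)) u y → ⟪ embed (v j) , y ⟫ ≡ 0ℚ
  v⊥ρ = proj₂ orthogonal
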